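{- Let $n\geq 2$ be an integer. Then there is an $(n+1)\times n^2$ sesqui-array on $n(n+1)$ letters whose column component design is partially balanced with respect to the rectangular association scheme $\mathrm{R}(n,n)$. Moreover, each column has intersection number $0$ with exactly $(n-1)^2$ other columns, intersection number $1$ with exactly $n-1$ other columns, and intersection number $n$ with exactly $n-1$ other columns.
   Context: An $r\times c$ array on a set of $v$ letters has exactly one letter in each cell, with $v>\max\{r,c\}$. Conditions: (A0) no letter occurs more than once in any row or any column; (A1) each letter occurs a constant number $k$ of times; (A2) the number of letters common to any two distinct rows is a non-zero constant; (A4) the number of letters common to any row and any column is a constant. A sesqui-array is such an array satisfying (A0), (A1), (A2) and (A4). The intersection number of two distinct columns is the number of letters they have in common. The column component design has the columns as points and the letters as blocks (a letter being incident with the columns in which it occurs). It is partially balanced with respect to the rectangular association scheme $\mathrm{R}(n,n)$ if the $n^2$ columns can be identified bijectively with the cells of an $n\times n$ grid so that the intersection number of two distinct columns depends only on whether the corresponding cells lie in the same row of the grid, in the same column of the grid, or neither. -}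

module Defs where

open import Data.Nat using (ℕ; zero; suc; _+_; _*_; _<_; _⊔_)
open import Data.Bool using (Bool; true; false; if_then_else_; _∧_; _∨_; not)
open import Data.Fin using (Fin; zero; suc)
open import Data.Fin.Properties using (_≟_)
open import Data.Nat.Properties using () renaming (_≟_ to _ℕ≟_)
open import Data.Product using (_×_; _,_; proj₁; proj₂; ∃; ∃-syntax)
open import Relation.Nullary using (¬_)
open import Relation.Nullary.Decidable using (⌊_⌋)
open import Relation.Binary.PropositionalEquality using (_≡_)
open import Function.Bundles using (_↔_; Inverse)

Array : ℕ → ℕ → ℕ → Set
Array r c v = Fin r → Fin c → Fin v

count : {n : ℕ} → (Fin n → Bool) → ℕ
count {zero}  p = 0
count {suc n} p = (if p zero then 1 else 0) + count (λ x → p (suc x))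

anyFin : {n : ℕ} → (Fin n → Bool) → Bool
anyFin {zero}  p = false
anyFin {suc n} p = p zero ∨ anyFin (λ x → p (suc x))

sumFin : {n : ℕ} → (Fin n → ℕ) → ℕ
sumFin {zero}  f = 0
sumFin {suc n} f = f zero + sumFin (λ x → f (suc x))

module _ {r c v : ℕ} (A : Array r c v) where

  inRow : Fin r → Fin v → Bool
  inRow i l = anyFin (λ j → ⌊ A i j ≟ l ⌋)

  inCol : Fin c → Fin v → Bool
  inCol j l = anyFin (λ i → ⌊ A i j ≟ l ⌋)

  occurrences : Fin v → ℕ
  occurrences l = sumFin (λ i → count (λ j → ⌊ A i j ≟ l ⌋))

  rowRowCommon : Fin r → Fin r → ℕ
  rowRowCommon i i' = count (λ l → inRow i l ∧ inRow i' l)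

  rowColCommon : Fin r → Fin c → ℕ
  rowColCommon i j = count (λ l → inRow i l ∧ inCol j l)

  colInt : Fin c → Fin c → ℕ
  colInt j j' = count (λ l → inCol j l ∧ inCol j' l)

  A0 : Set
  A0 = (∀ i j j' → A i j ≡ A i j' → j ≡ j') × (∀ j i i' → A i j ≡ A i' j → i ≡ i')

  A1 : Set
  A1 = ∃[ k ] (∀ l → occurrences l ≡ k)

  A2 : Set
  A2 = ∃[ λ₂ ] (¬ λ₂ ≡ 0 × (∀ i i' → ¬ i ≡ i' → rowRowCommon i i' ≡ λ₂))

  A4 : Set
  A4 = ∃[ μ ] (∀ i j → rowColCommon i j ≡ μ)

  -- sesqui-array (the standing assumption v > max{r,c} included)
  IsSesquiArray : Set
  IsSesquiArray = (r ⊔ c < v) × A0 × A1 × A2 × A4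

-- The column component design of an array with n² columns is partially
-- balanced w.r.t. R(n,n): there is a bijection of the columns with the cells
-- of an n × n grid such that the intersection number of two distinct columns
-- depends only on whether the cells share a grid row, a grid column, or neither.
PBRectangular : {r v : ℕ} (n : ℕ) → Array r (n * n) v → Set
PBRectangular {r} {v} n A =
  ∃[ φ ] ∃[ a ] ∃[ b ] ∃[ d ]
    ( (∀ j j' → ¬ j ≡ j' → proj₁ (f φ j) ≡ proj₁ (f φ j') → colInt A j j' ≡ a)
    × (∀ j j' → ¬ j ≡ j' → proj₂ (f φ j) ≡ proj₂ (f φ j') → colInt A j j' ≡ b)
    × (∀ j j' → ¬ proj₁ (f φ j) ≡ proj₁ (f φ j') → ¬ proj₂ (f φ j) ≡ proj₂ (f φ j')
         → colInt A j j' ≡ d))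
  where
    f : Fin (n * n) ↔ (Fin n × Fin n) → Fin (n * n) → Fin n × Fin n
    f φ = Inverse.to φ

colsWithInt : {r c v : ℕ} → Array r c v → Fin c → ℕ → ℕ
colsWithInt A j m = count (λ j' → not ⌊ j ≟ j' ⌋ ∧ ⌊ colInt A j j' ℕ≟ m ⌋)

-- Letters are pairs (a, s) ∈ Fin n × Fin (n + 1) and columns are the cells (x, y) of the
-- n × n grid.  Column (x, y) holds the n + 1 letters (x, s) for s ≠ 0 together with (y, 0),
-- so two distinct columns share n letters when they lie in a common grid row, one letter when
-- they lie in a common grid column, and none otherwise.  The letters of column (x, y) are
-- placed down the n + 1 rows by i ↦ rot x i + y + 1 (mod n + 1), where rot x fixes 0 and
-- rotates 1, …, n by x.  With this placement row i misses exactly the n letters (a, rot a i),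
-- one for each a; hence every letter lies in n rows, two rows share n(n − 1) letters, and a
-- row meets each column in n letters.

module Submission where

open import Defs
open import Data.Bool using (Bool; true; false; if_then_else_; _∧_; not; T)
open import Data.Bool.Properties using (∧-comm; ∧-identityʳ)
open import Data.Empty using (⊥-elim)
open import Data.Fin using (Fin; zero; suc; toℕ; combine; remQuot; _↑ˡ_; _↑ʳ_)
open import Data.Fin.Properties
  using (_≟_; *↔×; toℕ-injective; toℕ-fromℕ<; toℕ<n; remQuot-combine; combine-remQuot;
         combine-surjective; combine-injective; combine-injectiveʳ)
  renaming (suc-injective to Fin-suc-injective)
open import Data.Nat using (ℕ; zero; suc; _+_; _*_; _∸_; _%_; _≤_; _<_; _⊔_; s≤s; z≤n)
open import Data.Nat.DivMod using (_mod_; %-distribˡ-+; m%n%n≡m%n; [m+n]%n≡m%n; m<n⇒m%n≡m; m%n<n)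
open import Data.Nat.Properties
  using (+-assoc; +-comm; +-suc; +-identityʳ; *-identityʳ; *-zeroʳ; *-suc; suc-injective;
         m+[n∸m]≡n; m∸n+n≡m; <⇒≤; ⊔-lub; +-monoˡ-≤; +-commutativeSemigroup)
  renaming (_≟_ to _ℕ≟_)
open import Algebra.Properties.CommutativeSemigroup +-commutativeSemigroup
  using (interchange; x∙yz≈y∙xz)
open import Data.Product using (_×_; _,_; proj₁; proj₂; ∃; ∃₂; ∃-syntax)
open import Function using (_∘_)
open import Function.Bundles using (_⇔_; mk⇔; Equivalence)
open import Relation.Binary.PropositionalEquality
open import Relation.Nullary using (¬_; Dec; yes; no)
open import Relation.Nullary.Decidable
  using (⌊_⌋; ⌊⌋-map′; toWitness; fromWitness; toWitnessFalse; fromWitnessFalse)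

𝟙 : Bool → ℕ
𝟙 b = if b then 1 else 0

T-injective : ∀ {b c} → T b ⇔ T c → b ≡ c
T-injective {false} {false} _ = refl
T-injective {false} {true}  e = ⊥-elim (Equivalence.from e _)
T-injective {true}  {false} e = ⊥-elim (Equivalence.to e _)
T-injective {true}  {true}  _ = refl

⌊suc≟suc⌋ : ∀ {n} (x y : Fin n) → ⌊ suc x ≟ suc y ⌋ ≡ ⌊ x ≟ y ⌋
⌊suc≟suc⌋ x y = ⌊⌋-map′ _ _ (x ≟ y)

⌊⌋-true : ∀ {P : Set} (p? : Dec P) → P → ⌊ p? ⌋ ≡ true
⌊⌋-true (yes _) _ = refl
⌊⌋-true (no ¬p) p = ⊥-elim (¬p p)

⌊⌋-false : ∀ {P : Set} (p? : Dec P) → ¬ P → ⌊ p? ⌋ ≡ false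
⌊⌋-false (yes p) ¬p = ⊥-elim (¬p p)
⌊⌋-false (no _)  _  = refl

T-anyFin : ∀ {n} {p : Fin n → Bool} → T (anyFin p) ⇔ ∃ λ i → T (p i)
T-anyFin = mk⇔ to from
  where
  to : ∀ {n} {p : Fin n → Bool} → T (anyFin p) → ∃ λ i → T (p i)
  to {suc n} {p} t with p zero in p₀
  ... | true  = zero , subst T (sym p₀) _
  ... | false = let i , pᵢ = to t in suc i , pᵢ
  from : ∀ {n} {p : Fin n → Bool} → (∃ λ i → T (p i)) → T (anyFin p)
  from {p = p} (zero , pᵢ) with p zero
  ... | true = _
  from {p = p} (suc i , pᵢ) with p zero
  ... | true  = _
  ... | false = from (i , pᵢ)

T-anyFin-≟ : ∀ {n m} (f : Fin n → Fin m) u →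
  T (anyFin (λ i → ⌊ f i ≟ u ⌋)) ⇔ ∃ λ i → f i ≡ u
T-anyFin-≟ f u = mk⇔
  (λ t → let i , e = Equivalence.to T-anyFin t in i , toWitness e)
  (λ (i , e) → Equivalence.from T-anyFin (i , fromWitness e))

count-cong : ∀ {n} {p q : Fin n → Bool} → (∀ i → p i ≡ q i) → count p ≡ count q
count-cong {zero}  e = refl
count-cong {suc n} e = cong₂ _+_ (cong 𝟙 (e zero)) (count-cong (e ∘ suc))

sumFin-cong : ∀ {n} {f g : Fin n → ℕ} → (∀ i → f i ≡ g i) → sumFin f ≡ sumFin g
sumFin-cong {zero}  e = refl
sumFin-cong {suc n} e = cong₂ _+_ (e zero) (sumFin-cong (e ∘ suc))

count≡sumFin-𝟙 : ∀ {n} (p : Fin n → Bool) → count p ≡ sumFin (𝟙 ∘ p)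
count≡sumFin-𝟙 {zero}  p = refl
count≡sumFin-𝟙 {suc n} p = cong (𝟙 (p zero) +_) (count≡sumFin-𝟙 (p ∘ suc))

sumFin-const : ∀ n c → sumFin {n} (λ _ → c) ≡ n * c
sumFin-const zero    c = refl
sumFin-const (suc n) c = cong (c +_) (sumFin-const n c)

count-const : ∀ n b → count {n} (λ _ → b) ≡ (if b then n else 0)
count-const zero    true  = refl
count-const zero    false = refl
count-const (suc n) true  = cong suc (count-const n true)
count-const (suc n) false = count-const n false

sumFin-+ : ∀ {n} (f g : Fin n → ℕ) → sumFin (λ i → f i + g i) ≡ sumFin f + sumFin g
sumFin-+ {zero}  f g = refl
sumFin-+ {suc n} f g = trans (cong (f zero + g zero +_) (sumFin-+ (f ∘ suc) (g ∘ suc)))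
  (interchange (f zero) (g zero) _ _)

sumFin-comm : ∀ {m n} (f : Fin m → Fin n → ℕ) →
  sumFin (λ a → sumFin (f a)) ≡ sumFin (λ s → sumFin (λ a → f a s))
sumFin-comm {zero} {n} f = sym (trans (sumFin-const n 0) (*-zeroʳ n))
sumFin-comm {suc m} f = trans (cong (sumFin (f zero) +_) (sumFin-comm (f ∘ suc)))
  (sym (sumFin-+ (f zero) _))

∀-combine : ∀ {m n} {P : Fin (m * n) → Set} → (∀ a s → P (combine a s)) → ∀ l → P l
∀-combine {m} {n} {P} h l with a , s , e ← combine-surjective {m} {n} l = subst P e (h a s)

count-↑ : ∀ m n (p : Fin (m + n) → Bool) →
  count p ≡ count (p ∘ (_↑ˡ n)) + count (p ∘ (m ↑ʳ_))
count-↑ zero    n p = refl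
count-↑ (suc m) n p = trans (cong (𝟙 (p zero) +_) (count-↑ m n (p ∘ suc))) (sym (+-assoc (𝟙 (p zero)) _ _))

count-combine : ∀ m n (p : Fin (m * n) → Bool) →
  count p ≡ sumFin (λ (a : Fin m) → count (λ (s : Fin n) → p (combine a s)))
count-combine zero    n p = refl
count-combine (suc m) n p = trans (count-↑ n (m * n) p)
  (cong (count (p ∘ (_↑ˡ m * n)) +_) (count-combine m n (p ∘ (n ↑ʳ_))))

count-combine′ : ∀ m n (p : Fin (m * n) → Bool) →
  count p ≡ sumFin (λ (s : Fin n) → count (λ (a : Fin m) → p (combine a s)))
count-combine′ m n p = begin
  count p                                  ≡⟨ count-combine m n p ⟩
  sumFin (λ a → count (q a))               ≡⟨ sumFin-cong (λ a → count≡sumFin-𝟙 (q a)) ⟩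
  sumFin (λ a → sumFin (λ s → 𝟙 (q a s)))  ≡⟨ sumFin-comm (λ a s → 𝟙 (q a s)) ⟩
  sumFin (λ s → sumFin (λ a → 𝟙 (q a s)))  ≡⟨ sumFin-cong (λ s → count≡sumFin-𝟙 (λ a → q a s)) ⟨
  sumFin (λ s → count (λ a → q a s))       ∎
  where
  open ≡-Reasoning
  q : Fin m → Fin n → Bool
  q a s = p (combine a s)

count-remQuot : ∀ m n (g : Fin m → Fin n → Bool) →
  count (λ j → g (proj₁ (remQuot {m} n j)) (proj₂ (remQuot {m} n j))) ≡ sumFin (λ x → count (g x))
count-remQuot m n g = trans (count-combine m n _)
  (sumFin-cong λ x → count-cong λ y → cong (λ (x′ , y′) → g x′ y′) (remQuot-combine x y))

count-∧-∁ : ∀ {n} (q p : Fin n → Bool) →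
  count (λ i → q i ∧ p i) + count (λ i → not (q i) ∧ p i) ≡ count p
count-∧-∁ {zero}  q p = refl
count-∧-∁ {suc n} q p with q zero | p zero | count-∧-∁ (q ∘ suc) (p ∘ suc)
... | true  | true  | ih = cong suc ih
... | true  | false | ih = ih
... | false | true  | ih = trans (+-suc _ _) (cong suc ih)
... | false | false | ih = ih

count-≟-∧ : ∀ {n} (u : Fin n) (f : Fin n → Bool) → count (λ i → ⌊ i ≟ u ⌋ ∧ f i) ≡ 𝟙 (f u)
count-≟-∧ {suc n} zero f = trans (cong (𝟙 (f zero) +_) (count-const n false)) (+-identityʳ _)
count-≟-∧ (suc u) f = trans (count-cong (λ i → cong (_∧ f (suc i)) (⌊suc≟suc⌋ i u))) (count-≟-∧ u (f ∘ suc))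

count-≢-∧ : ∀ {n} (u : Fin n) (f : Fin n → Bool) →
  𝟙 (f u) + count (λ i → not ⌊ i ≟ u ⌋ ∧ f i) ≡ count f
count-≢-∧ u f = trans (cong (_+ count (λ i → not ⌊ i ≟ u ⌋ ∧ f i)) (sym (count-≟-∧ u f)))
  (count-∧-∁ (λ i → ⌊ i ≟ u ⌋) f)

count-≢ : ∀ {k} (u : Fin (suc k)) → count (λ i → not ⌊ i ≟ u ⌋) ≡ k
count-≢ {k} u = trans (count-cong (λ i → sym (∧-identityʳ (not ⌊ i ≟ u ⌋))))
  (suc-injective (trans (count-≢-∧ u (λ _ → true)) (count-const (suc k) true)))

count-≢-≢ : ∀ {k} {u v : Fin (suc (suc k))} → ¬ u ≡ v →
  count (λ i → not ⌊ i ≟ u ⌋ ∧ not ⌊ i ≟ v ⌋) ≡ k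
count-≢-≢ {u = u} {v} u≢v = suc-injective (begin
  suc c                            ≡⟨ cong (λ b → 𝟙 (not b) + c) (⌊⌋-false (u ≟ v) u≢v) ⟨
  𝟙 (not ⌊ u ≟ v ⌋) + c            ≡⟨ count-≢-∧ u (λ i → not ⌊ i ≟ v ⌋) ⟩
  count (λ i → not ⌊ i ≟ v ⌋)      ≡⟨ count-≢ v ⟩
  suc _                            ∎)
  where
  open ≡-Reasoning
  c = count (λ i → not ⌊ i ≟ u ⌋ ∧ not ⌊ i ≟ v ⌋)

count-unique : ∀ {n} (p : Fin n → Bool) → (∀ i j → T (p i) → T (p j) → i ≡ j) →
  count p ≡ 𝟙 (anyFin p)
count-unique {zero}  p unique = refl
count-unique {suc n} p unique with p zero in p₀
... | true  = cong suc (trans (count-cong none) (count-const n false))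
  where
  none : ∀ i → p (suc i) ≡ false
  none i with p (suc i) in pᵢ
  ... | true  with () ← unique zero (suc i) (subst T (sym p₀) _) (subst T (sym pᵢ) _)
  ... | false = refl
... | false = count-unique (p ∘ suc) (λ i j pᵢ pⱼ → Fin-suc-injective (unique (suc i) (suc j) pᵢ pⱼ))

sumFin-≟ : ∀ {k} (x : Fin (suc k)) (f : Bool → ℕ) → sumFin (λ x′ → f ⌊ x ≟ x′ ⌋) ≡ f true + k * f false
sumFin-≟ {k} zero f = cong (f true +_) (sumFin-const k (f false))
sumFin-≟ {suc k} (suc x) f = trans
  (cong (f false +_) (trans (sumFin-cong (λ x′ → cong f (⌊suc≟suc⌋ x x′))) (sumFin-≟ x f)))
  (x∙yz≈y∙xz (f false) (f true) _)

count-grid : ∀ {k} (x y : Fin (suc k)) (F : Bool → Bool → Bool) →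
  count (λ j → F ⌊ x ≟ proj₁ (remQuot {suc k} (suc k) j) ⌋ ⌊ y ≟ proj₂ (remQuot {suc k} (suc k) j) ⌋)
    ≡ (𝟙 (F true true) + k * 𝟙 (F true false)) + k * (𝟙 (F false true) + k * 𝟙 (F false false))
count-grid {k} x y F = begin
  count (λ j → g (proj₁ (remQuot {suc k} (suc k) j)) (proj₂ (remQuot {suc k} (suc k) j)))
    ≡⟨ count-remQuot _ _ g ⟩
  sumFin (λ x′ → count (g x′))
    ≡⟨ sumFin-cong (λ x′ → count≡sumFin-𝟙 (g x′)) ⟩
  sumFin (λ x′ → sumFin (λ y′ → 𝟙 (g x′ y′)))
    ≡⟨ sumFin-cong (λ x′ → sumFin-≟ y (𝟙 ∘ F ⌊ x ≟ x′ ⌋)) ⟩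
  sumFin (λ x′ → 𝟙 (F ⌊ x ≟ x′ ⌋ true) + k * 𝟙 (F ⌊ x ≟ x′ ⌋ false))
    ≡⟨ sumFin-≟ x (λ b → 𝟙 (F b true) + k * 𝟙 (F b false)) ⟩
  (𝟙 (F true true) + k * 𝟙 (F true false)) + k * (𝟙 (F false true) + k * 𝟙 (F false false))
    ∎
  where
  open ≡-Reasoning
  g : Fin (suc k) → Fin (suc k) → Bool
  g x′ y′ = F ⌊ x ≟ x′ ⌋ ⌊ y ≟ y′ ⌋

occurrences≡count-inRow : ∀ {r c v} (A : Array r c v) → (∀ i j j′ → A i j ≡ A i j′ → j ≡ j′) →
  ∀ l → occurrences A l ≡ count (λ i → inRow A i l)
occurrences≡count-inRow A rowInjective l = trans
  (sumFin-cong λ i → count-unique (λ j → ⌊ A i j ≟ l ⌋)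
    (λ j j′ p q → rowInjective i j j′ (trans (toWitness p) (sym (toWitness q)))))
  (sym (count≡sumFin-𝟙 (λ i → inRow A i l)))

module ModularArithmetic {m : ℕ} where
  private
    N = suc m

    shift : ℕ → Fin N → Fin N
    shift u a = (toℕ a + u) mod N

  infixl 6 _⊕_ _⊖_

  _⊕_ : Fin N → Fin N → Fin N
  a ⊕ b = shift (toℕ b) a

  _⊖_ : Fin N → Fin N → Fin N
  a ⊖ b = shift (N ∸ toℕ b) a

  private
    toℕ-shift : ∀ u a → toℕ (shift u a) ≡ (toℕ a + u) % N
    toℕ-shift u a = toℕ-fromℕ< (m%n<n (toℕ a + u) N)

    %-absorbˡ : ∀ x y → (x % N + y) % N ≡ (x + y) % N
    %-absorbˡ x y = begin
      (x % N + y) % N          ≡⟨ %-distribˡ-+ (x % N) y N ⟩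
      (x % N % N + y % N) % N  ≡⟨ cong (λ z → (z + y % N) % N) (m%n%n≡m%n x N) ⟩
      (x % N + y % N) % N      ≡⟨ %-distribˡ-+ x y N ⟨
      (x + y) % N              ∎
      where open ≡-Reasoning

    shift-shift : ∀ {u v} a → u + v ≡ N → shift v (shift u a) ≡ a
    shift-shift {u} {v} a u+v≡N = toℕ-injective (begin
      toℕ (shift v (shift u a))     ≡⟨ toℕ-shift v (shift u a) ⟩
      (toℕ (shift u a) + v) % N     ≡⟨ cong (λ z → (z + v) % N) (toℕ-shift u a) ⟩
      ((toℕ a + u) % N + v) % N     ≡⟨ %-absorbˡ (toℕ a + u) v ⟩
      (toℕ a + u + v) % N           ≡⟨ cong (_% N) (trans (+-assoc (toℕ a) u v) (cong (toℕ a +_) u+v≡N)) ⟩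
      (toℕ a + N) % N               ≡⟨ [m+n]%n≡m%n (toℕ a) N ⟩
      toℕ a % N                     ≡⟨ m<n⇒m%n≡m (toℕ<n a) ⟩
      toℕ a                         ∎)
      where open ≡-Reasoning

  ⊖-⊕ : ∀ a b → a ⊖ b ⊕ b ≡ a
  ⊖-⊕ a b = shift-shift a (m∸n+n≡m (<⇒≤ (toℕ<n b)))

  ⊕-⊖ : ∀ a b → a ⊕ b ⊖ b ≡ a
  ⊕-⊖ a b = shift-shift a (m+[n∸m]≡n (<⇒≤ (toℕ<n b)))

  ⊕-comm : ∀ a b → a ⊕ b ≡ b ⊕ a
  ⊕-comm a b = cong (_mod N) (+-comm (toℕ a) (toℕ b))

  ⊕-identityˡ : ∀ a → zero ⊕ a ≡ a
  ⊕-identityˡ a = toℕ-injective (trans (toℕ-shift (toℕ a) zero) (m<n⇒m%n≡m (toℕ<n a)))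

  ⊕-identityʳ : ∀ a → a ⊕ zero ≡ a
  ⊕-identityʳ a = trans (⊕-comm a zero) (⊕-identityˡ a)

  ⊕-cancelʳ : ∀ {a a′} b → a ⊕ b ≡ a′ ⊕ b → a ≡ a′
  ⊕-cancelʳ {a} {a′} b e = trans (sym (⊕-⊖ a b)) (trans (cong (_⊖ b) e) (⊕-⊖ a′ b))

  ⊕-cancelˡ : ∀ a {b b′} → a ⊕ b ≡ a ⊕ b′ → b ≡ b′
  ⊕-cancelˡ a {b} {b′} e = ⊕-cancelʳ a (trans (⊕-comm b a) (trans e (⊕-comm a b′)))

  ⊕-suc≢ : ∀ c y → ¬ c ⊕ suc y ≡ c
  ⊕-suc≢ c y e with () ← ⊕-cancelˡ c (trans e (sym (⊕-identityʳ c)))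

  ∃-⊕-suc : ∀ c e → ¬ e ≡ c → ∃ λ y → c ⊕ suc y ≡ e
  ∃-⊕-suc c e e≢c with e ⊖ c in eq
  ... | zero  = ⊥-elim (e≢c (trans (sym (⊖-⊕ e c)) (trans (cong (_⊕ c) eq) (⊕-identityˡ c))))
  ... | suc y = y , trans (⊕-comm c (suc y)) (trans (cong (_⊕ c) (sym eq)) (⊖-⊕ e c))

module Construction (k : ℕ) where
  open ModularArithmetic

  n N : ℕ
  n = suc k
  N = suc n

  rot : Fin n → Fin N → Fin N
  rot a zero    = zero
  rot a (suc t) = suc (t ⊕ a)

  rot⁻¹ : Fin n → Fin N → Fin N
  rot⁻¹ a zero    = zero
  rot⁻¹ a (suc t) = suc (t ⊖ a)

  rot-rot⁻¹ : ∀ a s → rot a (rot⁻¹ a s) ≡ s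
  rot-rot⁻¹ a zero    = refl
  rot-rot⁻¹ a (suc t) = cong suc (⊖-⊕ t a)

  rot⁻¹-rot : ∀ a i → rot⁻¹ a (rot a i) ≡ i
  rot⁻¹-rot a zero    = refl
  rot⁻¹-rot a (suc t) = cong suc (⊕-⊖ t a)

  rot-injective : ∀ a {i i′} → rot a i ≡ rot a i′ → i ≡ i′
  rot-injective a {i} {i′} e = trans (sym (rot⁻¹-rot a i)) (trans (cong (rot⁻¹ a) e) (rot⁻¹-rot a i′))

  pos : Fin n → Fin n → Fin N → Fin N
  pos x y i = rot x i ⊕ suc y

  block : Fin n → Fin n → Fin N → Fin n
  block x y zero    = y
  block x y (suc _) = x

  -- The s-th letter of column (x, y) is (block x y s , s); row i holds its (pos x y i)-th letter.
  cell : Fin n → Fin n → Fin N → Fin (n * N)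
  cell x y i = combine (block x y (pos x y i)) (pos x y i)

  gridRow gridCol : Fin (n * n) → Fin n
  gridRow j = proj₁ (remQuot {n} n j)
  gridCol j = proj₂ (remQuot {n} n j)

  array : Array N (n * n) (n * N)
  array i j = cell (gridRow j) (gridCol j) i

  cell-at : ∀ x y i {s} → pos x y i ≡ s → cell x y i ≡ combine (block x y s) s
  cell-at x y i = cong (λ e → combine (block x y e) e)

  pos-surjective : ∀ x y s → pos x y (rot⁻¹ x (s ⊖ suc y)) ≡ s
  pos-surjective x y s = trans (cong (_⊕ suc y) (rot-rot⁻¹ x (s ⊖ suc y))) (⊖-⊕ s (suc y))

  cell-injectiveʳ : ∀ {x y i i′} → cell x y i ≡ cell x y i′ → i ≡ i′
  cell-injectiveʳ {x} {y} {i} {i′} e = rot-injective x (⊕-cancelʳ (suc y)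
    (combine-injectiveʳ (block x y (pos x y i)) (pos x y i) (block x y (pos x y i′)) (pos x y i′) e))

  pos≡zero-injective : ∀ {x x′ y} i → pos x y i ≡ zero → pos x′ y i ≡ zero → x ≡ x′
  pos≡zero-injective {y = y} zero p _ with () ← trans (sym (⊕-identityˡ (suc y))) p
  pos≡zero-injective {y = y} (suc t) p p′ =
    ⊕-cancelˡ t (Fin-suc-injective (⊕-cancelʳ (suc y) (trans p (sym p′))))

  cell-injectiveˡ : ∀ {x y x′ y′} i → cell x y i ≡ cell x′ y′ i → x ≡ x′ × y ≡ y′
  cell-injectiveˡ {x} {y} {x′} {y′} i e
    with pos x y i in p | pos x′ y′ i in p′
       | combine-injective (block x y (pos x y i)) (pos x y i) (block x′ y′ (pos x′ y′ i)) (pos x′ y′ i) e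
  ... | zero  | zero  | refl , _ = pos≡zero-injective i p p′ , refl
  ... | suc u | suc _ | refl , refl = refl , Fin-suc-injective (⊕-cancelˡ (rot x i) (trans p (sym p′)))

  cell-avoids : ∀ x y i a → ¬ cell x y i ≡ combine a (rot a i)
  cell-avoids x y i a e with pos x y i in p | combine-injective (block x y (pos x y i)) (pos x y i) a (rot a i) e
  cell-avoids x y zero    a e | zero  | refl , _ with () ← trans (sym (⊕-identityˡ (suc y))) p
  cell-avoids x y (suc t) a e | zero  | refl , ()
  cell-avoids x y i       a e | suc u | refl , u≡rot = ⊕-suc≢ (rot x i) y (trans p u≡rot)

  cell-reaches : ∀ i a s → ¬ s ≡ rot a i → ∃₂ λ x y → cell x y i ≡ combine a s
  cell-reaches i a (suc u) s≢rot = let y , p = ∃-⊕-suc (rot a i) (suc u) s≢rot in a , y , cell-at a y i p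
  cell-reaches zero    a zero s≢rot with () ← s≢rot refl
  cell-reaches (suc t) a zero _ with w , a+w≡0 ← ∃-⊕-suc (suc a) zero (λ ()) =
    w ⊖ t , a , cell-at (w ⊖ t) a (suc t) (begin
      suc (t ⊕ (w ⊖ t)) ⊕ suc a  ≡⟨ cong (λ z → suc z ⊕ suc a) (trans (⊕-comm t (w ⊖ t)) (⊖-⊕ w t)) ⟩
      suc w ⊕ suc a              ≡⟨ ⊕-comm (suc w) (suc a) ⟩
      suc a ⊕ suc w              ≡⟨ a+w≡0 ⟩
      zero                       ∎)
    where open ≡-Reasoning

  cell-in-column : ∀ x y i {a s} → cell x y i ≡ combine a s → a ≡ block x y s
  cell-in-column x y i {a} {s} e
    with refl , refl ← combine-injective (block x y (pos x y i)) (pos x y i) a s e = refl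

  column-reaches : ∀ x y s → ∃ λ i → cell x y i ≡ combine (block x y s) s
  column-reaches x y s = rot⁻¹ x (s ⊖ suc y) , cell-at x y (rot⁻¹ x (s ⊖ suc y)) (pos-surjective x y s)

  array-combine : ∀ i x y → array i (combine x y) ≡ cell x y i
  array-combine i x y = cong (λ (x , y) → cell x y i) (remQuot-combine x y)

  grid-injective : ∀ {j j′} → gridRow j ≡ gridRow j′ → gridCol j ≡ gridCol j′ → j ≡ j′
  grid-injective {j} {j′} e₁ e₂ =
    trans (sym (combine-remQuot {n} n j)) (trans (cong₂ combine e₁ e₂) (combine-remQuot n j′))

  ⌊≟⌋-grid : ∀ j j′ → ⌊ j ≟ j′ ⌋ ≡ ⌊ gridRow j ≟ gridRow j′ ⌋ ∧ ⌊ gridCol j ≟ gridCol j′ ⌋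
  ⌊≟⌋-grid j j′ with j ≟ j′ | gridRow j ≟ gridRow j′ | gridCol j ≟ gridCol j′
  ... | yes refl | yes _  | yes _  = refl
  ... | yes refl | no ≢₁  | _      = ⊥-elim (≢₁ refl)
  ... | yes refl | yes _  | no ≢₂  = ⊥-elim (≢₂ refl)
  ... | no j≢j′  | yes e₁ | yes e₂ = ⊥-elim (j≢j′ (grid-injective e₁ e₂))
  ... | no _     | yes _  | no _   = refl
  ... | no _     | no _   | _      = refl

  inRow-array : ∀ i a s → inRow array i (combine a s) ≡ not ⌊ s ≟ rot a i ⌋
  inRow-array i a s = T-injective (mk⇔ to from)
    where
    to : T (inRow array i (combine a s)) → T (not ⌊ s ≟ rot a i ⌋)
    to t with j , e ← Equivalence.to (T-anyFin-≟ (array i) (combine a s)) t =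
      fromWitnessFalse λ { refl → cell-avoids (gridRow j) (gridCol j) i a e }
    from : T (not ⌊ s ≟ rot a i ⌋) → T (inRow array i (combine a s))
    from t with x , y , e ← cell-reaches i a s (toWitnessFalse t) =
      Equivalence.from (T-anyFin-≟ (array i) (combine a s)) (combine x y , trans (array-combine i x y) e)

  inCol-array : ∀ j a s → inCol array j (combine a s) ≡ ⌊ a ≟ block (gridRow j) (gridCol j) s ⌋
  inCol-array j a s = T-injective (mk⇔ to from)
    where
    to : T (inCol array j (combine a s)) → T ⌊ a ≟ block (gridRow j) (gridCol j) s ⌋
    to t = let i , e = Equivalence.to (T-anyFin-≟ (λ i → array i j) (combine a s)) t
           in fromWitness (cell-in-column (gridRow j) (gridCol j) i e)
    from : T ⌊ a ≟ block (gridRow j) (gridCol j) s ⌋ → T (inCol array j (combine a s))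
    from t with refl ← toWitness t =
      Equivalence.from (T-anyFin-≟ (λ i → array i j) _) (column-reaches (gridRow j) (gridCol j) s)

  array-A0 : A0 array
  array-A0 = (λ i j j′ e → let e₁ , e₂ = cell-injectiveˡ i e in grid-injective e₁ e₂)
           , (λ j i i′ → cell-injectiveʳ)

  ⌊≟rot⌋ : ∀ a i s → ⌊ s ≟ rot a i ⌋ ≡ ⌊ i ≟ rot⁻¹ a s ⌋
  ⌊≟rot⌋ a i s with s ≟ rot a i | i ≟ rot⁻¹ a s
  ... | yes _    | yes _ = refl
  ... | yes refl | no ≢  = ⊥-elim (≢ (sym (rot⁻¹-rot a i)))
  ... | no ≢     | yes refl = ⊥-elim (≢ (sym (rot-rot⁻¹ a s)))
  ... | no _     | no _  = refl

  occurrences-array : ∀ l → occurrences array l ≡ n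
  occurrences-array = ∀-combine λ a s → begin
    occurrences array (combine a s)
      ≡⟨ occurrences≡count-inRow array (proj₁ array-A0) (combine a s) ⟩
    count (λ i → inRow array i (combine a s))
      ≡⟨ count-cong (λ i → trans (inRow-array i a s) (cong not (⌊≟rot⌋ a i s))) ⟩
    count (λ i → not ⌊ i ≟ rot⁻¹ a s ⌋)
      ≡⟨ count-≢ (rot⁻¹ a s) ⟩
    n ∎
    where open ≡-Reasoning

  rowRowCommon-array : ∀ i i′ → ¬ i ≡ i′ → rowRowCommon array i i′ ≡ n * k
  rowRowCommon-array i i′ i≢i′ = begin
    rowRowCommon array i i′   ≡⟨ count-combine n N (λ l → inRow array i l ∧ inRow array i′ l) ⟩
    sumFin (λ (a : Fin n) → count (λ (s : Fin N) → inRow array i (combine a s) ∧ inRow array i′ (combine a s)))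
      ≡⟨ sumFin-cong (λ a → trans (count-cong λ s → cong₂ _∧_ (inRow-array i a s) (inRow-array i′ a s))
                                  (count-≢-≢ (i≢i′ ∘ rot-injective a))) ⟩
    sumFin {n} (λ _ → k)      ≡⟨ sumFin-const n k ⟩
    n * k                     ∎
    where open ≡-Reasoning

  column∩row : ∀ x y i → count (λ s → not ⌊ s ≟ rot (block x y s) i ⌋) ≡ n
  column∩row x y zero     = count-const n true
  column∩row x y (suc t₀) =
    cong suc (trans (count-cong (λ t → cong not (⌊suc≟suc⌋ t (t₀ ⊕ x)))) (count-≢ (t₀ ⊕ x)))

  rowColCommon-array : ∀ i j → rowColCommon array i j ≡ n
  rowColCommon-array i j = begin
    rowColCommon array i j
      ≡⟨ count-combine′ n N (λ l → inRow array i l ∧ inCol array j l) ⟩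
    sumFin (λ (s : Fin N) → count (λ (a : Fin n) → inRow array i (combine a s) ∧ inCol array j (combine a s)))
      ≡⟨ sumFin-cong (λ s → trans (count-cong (row∧column s))
                                  (count-≟-∧ (block x y s) (λ a → not ⌊ s ≟ rot a i ⌋))) ⟩
    sumFin (λ (s : Fin N) → 𝟙 (not ⌊ s ≟ rot (block x y s) i ⌋))
      ≡⟨ count≡sumFin-𝟙 (λ s → not ⌊ s ≟ rot (block x y s) i ⌋) ⟨
    count (λ s → not ⌊ s ≟ rot (block x y s) i ⌋)
      ≡⟨ column∩row x y i ⟩
    n ∎
    where
    open ≡-Reasoning
    x = gridRow j
    y = gridCol j
    row∧column : ∀ s a → inRow array i (combine a s) ∧ inCol array j (combine a s)
                         ≡ ⌊ a ≟ block x y s ⌋ ∧ not ⌊ s ≟ rot a i ⌋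
    row∧column s a = trans (cong₂ _∧_ (inRow-array i a s) (inCol-array j a s))
                           (∧-comm (not ⌊ s ≟ rot a i ⌋) ⌊ a ≟ block x y s ⌋)

  colInt-array : ∀ j j′ →
    colInt array j j′ ≡ 𝟙 ⌊ gridCol j ≟ gridCol j′ ⌋ + (if ⌊ gridRow j ≟ gridRow j′ ⌋ then n else 0)
  colInt-array j j′ = begin
    colInt array j j′   ≡⟨ count-combine′ n N (λ l → inCol array j l ∧ inCol array j′ l) ⟩
    sumFin (λ (s : Fin N) → count (λ (a : Fin n) → inCol array j (combine a s) ∧ inCol array j′ (combine a s)))
      ≡⟨ sumFin-cong (λ s → trans (count-cong λ a → cong₂ _∧_ (inCol-array j a s) (inCol-array j′ a s))
                                  (count-≟-∧ (block x y s) (λ a → ⌊ a ≟ block x′ y′ s ⌋))) ⟩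
    sumFin (λ (s : Fin N) → 𝟙 ⌊ block x y s ≟ block x′ y′ s ⌋)
      ≡⟨ cong (𝟙 ⌊ y ≟ y′ ⌋ +_)
              (trans (sym (count≡sumFin-𝟙 {n} (λ _ → ⌊ x ≟ x′ ⌋))) (count-const n _)) ⟩
    𝟙 ⌊ y ≟ y′ ⌋ + (if ⌊ x ≟ x′ ⌋ then n else 0)   ∎
    where
    open ≡-Reasoning
    x = gridRow j
    y = gridCol j
    x′ = gridRow j′
    y′ = gridCol j′

  array-PBRectangular : PBRectangular n array
  array-PBRectangular = *↔× , n , 1 , 0 , sameRow , sameCol , neither
    where
    colInt≡ : ∀ j j′ {b c} → ⌊ gridCol j ≟ gridCol j′ ⌋ ≡ b → ⌊ gridRow j ≟ gridRow j′ ⌋ ≡ c →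
      colInt array j j′ ≡ 𝟙 b + (if c then n else 0)
    colInt≡ j j′ e₁ e₂ = trans (colInt-array j j′) (cong₂ (λ b c → 𝟙 b + (if c then n else 0)) e₁ e₂)
    sameRow : ∀ j j′ → ¬ j ≡ j′ → gridRow j ≡ gridRow j′ → colInt array j j′ ≡ n
    sameRow j j′ j≢j′ e = colInt≡ j j′
      (⌊⌋-false (gridCol j ≟ gridCol j′) (j≢j′ ∘ grid-injective e)) (⌊⌋-true (gridRow j ≟ gridRow j′) e)
    sameCol : ∀ j j′ → ¬ j ≡ j′ → gridCol j ≡ gridCol j′ → colInt array j j′ ≡ 1
    sameCol j j′ j≢j′ e = colInt≡ j j′
      (⌊⌋-true (gridCol j ≟ gridCol j′) e)
      (⌊⌋-false (gridRow j ≟ gridRow j′) (λ e₁ → j≢j′ (grid-injective e₁ e)))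
    neither : ∀ j j′ → ¬ gridRow j ≡ gridRow j′ → ¬ gridCol j ≡ gridCol j′ → colInt array j j′ ≡ 0
    neither j j′ ≢₁ ≢₂ = colInt≡ j j′
      (⌊⌋-false (gridCol j ≟ gridCol j′) ≢₂) (⌊⌋-false (gridRow j ≟ gridRow j′) ≢₁)

  colIntIs : ℕ → Bool → Bool → Bool
  colIntIs m sameRow sameCol =
    not (sameRow ∧ sameCol) ∧ ⌊ 𝟙 sameCol + (if sameRow then n else 0) ℕ≟ m ⌋

  colsWithInt-array : ∀ j m → colsWithInt array j m ≡
    (𝟙 (colIntIs m true true) + k * 𝟙 (colIntIs m true false))
      + k * (𝟙 (colIntIs m false true) + k * 𝟙 (colIntIs m false false))
  colsWithInt-array j m = trans
    (count-cong (λ j′ → cong₂ (λ b c → not b ∧ ⌊ c ℕ≟ m ⌋) (⌊≟⌋-grid j j′) (colInt-array j j′)))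
    (count-grid (gridRow j) (gridCol j) (colIntIs m))

letters-exceed-dims : ∀ n → 2 ≤ n → suc n ⊔ n * n < n * suc n
letters-exceed-dims n@(suc (suc _)) (s≤s (s≤s z≤n)) rewrite *-suc n n = ⊔-lub
  (subst (suc (suc n) ≤_) (+-comm (n * n) n) (+-monoˡ-≤ n {2} {n * n} (s≤s (s≤s z≤n))))
  (+-monoˡ-≤ (n * n) {1} {n} (s≤s z≤n))

mainTheorem2 : (n : ℕ) → 2 ≤ n →
    ∃[ A ] (IsSesquiArray {suc n} {n * n} {n * suc n} A × PBRectangular n A
      × (∀ j → colsWithInt A j 0 ≡ (n ∸ 1) * (n ∸ 1)
             × colsWithInt A j 1 ≡ n ∸ 1
             × colsWithInt A j n ≡ n ∸ 1))
mainTheorem2 (suc (suc r)) 2≤n@(s≤s (s≤s z≤n)) =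
  array
  , ( letters-exceed-dims n 2≤n , array-A0 , (n , occurrences-array)
    , (n * k , (λ ()) , rowRowCommon-array) , (n , rowColCommon-array))
  , array-PBRectangular
  , λ j → trans (colsWithInt-array j 0) int0 , trans (colsWithInt-array j 1) int1
        , trans (colsWithInt-array j n) intn
  where
  k = suc r
  open Construction k
  -- Since k = suc r, every indicator 𝟙 (colIntIs m _ _) below is computed by normalisation,
  -- except ⌊ n ℕ≟ n ⌋, whose operands are not numerals.
  int0 : k * 0 + k * (k * 1) ≡ k * k
  int0 = cong₂ (λ a b → a + k * b) (*-zeroʳ k) (*-identityʳ k)
  int1 : k * 0 + k * suc (k * 0) ≡ k
  int1 = trans (cong₂ (λ a b → a + k * suc b) (*-zeroʳ k) (*-zeroʳ k)) (*-identityʳ k)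
  intn : k * 𝟙 ⌊ n ℕ≟ n ⌋ + k * (k * 0) ≡ k
  intn = trans (cong₂ (λ b c → k * 𝟙 b + k * c) (⌊⌋-true (n ℕ≟ n) refl) (*-zeroʳ k))
    (trans (cong₂ _+_ (*-identityʳ k) (*-zeroʳ k)) (+-identityʳ k))
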